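{- There exists an embedded planar $st$-graph that admits no bitonic $st$-ordering.
   Context: A planar $st$-graph is a planar, acyclic directed graph without parallel edges with exactly one source $s$ and exactly one sink $t$ (the edge $(s,t)$ need not be present); embedded means a fixed planar embedding with $s$ and $t$ on the outer face. The successor list $S(u)=\{v_1,\dots,v_m\}$ lists the heads of the outgoing edges of $u$ in clockwise order around $u$ in the embedding; for $u=s$, $v_1$ and $v_m$ are chosen so that $v_m,s,v_1$ appear clockwise on the outer face. An $st$-ordering is a bijection $\pi:V\to\{1,\dots,|V|\}$ with $\pi(u)<\pi(v)$ for every edge $(u,v)$; it is bitonic if for every $u$ with $S(u)=\{v_1,\dots,v_m\}$ there is $1\le h\le m$ with $\pi(v_1)<\dots<\pi(v_h)>\dots>\pi(v_m)$. -}

module Defs where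

open import Data.Nat using (ℕ; zero; suc; _+_; _*_; _≤ᵇ_)
open import Data.Fin as Fin using (Fin; toℕ)
open import Data.Bool using (Bool; true; false; T; if_then_else_; _∨_; _∧_)
open import Data.List using (List; []; _∷_; _++_; _∷ʳ_; filterᵇ; allFin; cartesianProduct; upTo; map)
open import Data.Bool.ListAction using (and)
open import Data.List.Relation.Unary.All using (All)
open import Data.List.Relation.Unary.Linked using (Linked)
open import Data.List.Relation.Unary.Unique.Propositional using (Unique)
open import Data.List.Membership.Propositional using (_∈_)
open import Data.Product using (_×_; _,_; proj₁; proj₂; ∃; ∃-syntax)
open import Data.Sum using (_⊎_)
open import Relation.Nullary using (¬_; does)
open import Relation.Binary.PropositionalEquality using (_≡_)
open import Relation.Binary.Construct.Closure.Transitive using (TransClosure)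
open import Function.Bundles using (_⇔_)
open import Function.Definitions using (Bijective)

-- Graphs on the vertex set Fin n.  A directed graph without parallel
-- edges is given by a Boolean adjacency matrix  E u v = "edge (u,v)".

Edge : ∀ {n} → (Fin n → Fin n → Bool) → Fin n → Fin n → Set
Edge E u v = T (E u v)

adjᵇ : ∀ {n} → (Fin n → Fin n → Bool) → Fin n → Fin n → Bool
adjᵇ E u v = E u v ∨ E v u

Adj : ∀ {n} → (Fin n → Fin n → Bool) → Fin n → Fin n → Set
Adj E u v = T (adjᵇ E u v)

-- Combinatorial embeddings (rotation systems).
-- rot u lists the neighbours of u in clockwise order around u (a cyclic
-- list).  A dart (u , v) is the edge {u,v} traversed from u to v.

Dart : ℕ → Set
Dart n = Fin n × Fin n

nextCW : ∀ {n} → List (Fin n) → Fin n → Fin n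
nextCW []       x = x
nextCW (y ∷ ys) x = go (y ∷ ys)
  where
  go : List _ → Fin _
  go []           = x
  go (z ∷ [])     = if does (z Fin.≟ x) then y else x
  go (z ∷ w ∷ zs) = if does (z Fin.≟ x) then w else go (w ∷ zs)

-- face-tracing permutation: after traversing (u , v), continue along
-- (v , w) where w is the clockwise successor of u around v
-- (the traced face lies to the left of the walk).
φ : ∀ {n} → (Fin n → List (Fin n)) → Dart n → Dart n
φ rot (u , v) = (v , nextCW (rot v) u)

iter : ∀ {A : Set} → ℕ → (A → A) → A → A
iter zero    f a = a
iter (suc k) f a = f (iter k f a)

allPairs : (n : ℕ) → List (Dart n)
allPairs n = cartesianProduct (allFin n) (allFin n)

countᵇ : ∀ {A : Set} → (A → Bool) → List A → ℕ
countᵇ p []       = 0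
countᵇ p (x ∷ xs) = if p x then suc (countᵇ p xs) else countᵇ p xs

numEdges : ∀ {n} → (Fin n → Fin n → Bool) → ℕ
numEdges {n} E = countᵇ (λ d → E (proj₁ d) (proj₂ d)) (allPairs n)

numDarts : ∀ {n} → (Fin n → Fin n → Bool) → ℕ
numDarts {n} E = countᵇ (λ d → adjᵇ E (proj₁ d) (proj₂ d)) (allPairs n)

-- injective code of a dart, used to pick one representative per orbit
code : ∀ {n} → Dart n → ℕ
code {n} (u , v) = toℕ u * n + toℕ v

-- d is the representative (code-minimal dart) of its face orbit;
-- an orbit of a permutation of the D darts is {φ^k d | k < D}
isRep : ∀ {n} → (Fin n → Fin n → Bool) → (Fin n → List (Fin n)) → Dart n → Bool
isRep E rot d = and (map (λ k → code d ≤ᵇ code (iter k (φ rot) d)) (upTo (numDarts E)))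

-- number of faces = number of orbits of φ on the darts
numFaces : ∀ {n} → (Fin n → Fin n → Bool) → (Fin n → List (Fin n)) → ℕ
numFaces {n} E rot =
  countᵇ (λ d → adjᵇ E (proj₁ d) (proj₂ d) ∧ isRep E rot d) (allPairs n)

OnFace : ∀ {n} → (Fin n → List (Fin n)) → Dart n → Dart n → Set
OnFace rot o e = ∃[ k ] iter k (φ rot) o ≡ e

VertexOnFace : ∀ {n} → (Fin n → List (Fin n)) → Dart n → Fin n → Set
VertexOnFace rot o v = ∃[ k ] proj₁ (iter k (φ rot) o) ≡ v

record PlanarSTGraph (n : ℕ) : Set where
  field
    E     : Fin n → Fin n → Bool
    rot   : Fin n → List (Fin n)
    s t   : Fin n
    outer : Dart n
    -- acyclic (hence no loops, no antiparallel edges)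
    acyclic  : ∀ v → ¬ TransClosure (Edge E) v v
    source   : ∀ v → (∀ u → ¬ Edge E u v) ⇔ (v ≡ s)
    sink     : ∀ v → (∀ w → ¬ Edge E v w) ⇔ (v ≡ t)
    rot-unique : ∀ u → Unique (rot u)
    rot-nbrs   : ∀ u v → (v ∈ rot u) ⇔ Adj E u v
    -- planarity of the embedding (genus 0; the graph is connected since
    -- every vertex is reachable from the unique source): Euler's formula
    -- V - E + F = 2
    euler    : n + numFaces E rot ≡ 2 + numEdges E
    outer-dart : Adj E (proj₁ outer) (proj₂ outer)
    s-outer  : VertexOnFace rot outer s
    t-outer  : VertexOnFace rot outer t

open PlanarSTGraph public

-- st-orderings (values in Fin n, i.e. 0..n-1 instead of 1..n)

IsSTOrdering : ∀ {n} → PlanarSTGraph n → (Fin n → Fin n) → Set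
IsSTOrdering G π =
  Bijective _≡_ _≡_ π × (∀ u v → Edge (E G) u v → π u Fin.< π v)

Bitonic : ∀ {n} → (Fin n → Fin n) → List (Fin n) → Set
Bitonic π L =
  L ≡ [] ⊎
  ∃ λ P → ∃ λ x → ∃ λ Q →
    L ≡ P ++ x ∷ Q
    × Linked (λ a b → π a Fin.< π b) (P ∷ʳ x)
    × Linked (λ a b → π a Fin.> π b) (x ∷ Q)

-- Successor lists.
-- * for s: the clockwise order of the neighbours of s starting right
--   after the outer-face angle at s, i.e. after the neighbour x = v_m with
--   (x , s) a dart of the outer face (so v_m, s, v_1 occur consecutively
--   along the outer face);
-- * for u ≠ s: the outgoing neighbours in clockwise order, where the
--   cyclic rotation at u is cut as (incoming block) ++ (outgoing block).
IsBitonic : ∀ {n} → PlanarSTGraph n → (Fin n → Fin n) → Set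
IsBitonic G π =
  (∀ x A B → OnFace (rot G) (outer G) (x , s G) →
     rot G (s G) ≡ (A ∷ʳ x) ++ B →
     Bitonic π (filterᵇ (E G (s G)) (B ++ (A ∷ʳ x))))
  × (∀ u → ¬ (u ≡ s G) → ∀ A B ins outs →
     rot G u ≡ A ++ B → B ++ A ≡ ins ++ outs →
     All (λ v → Edge (E G) v u) ins → All (λ v → Edge (E G) u v) outs →
     Bitonic π outs)

module Submission where

-- The witness has five vertices s = 0, 1, 2, 3, t = 4 and the edges
--   s→1, s→2, s→3, 1→2, 1→3, 2→4, 3→4,
-- embedded so that the successor list of s is (2, 1, 3): vertex 1 sits
-- between 2 and 3 in the clockwise order around s.  Every st-ordering π
-- must respect the edges 1→2 and 1→3, so π(1) < π(2) and π(1) < π(3):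
-- the successor list of s has a "valley" at 1, which no bitonic list can
-- have.

open import Defs
open import Data.Nat using (ℕ)
open import Data.Fin using (Fin; zero; suc; _<_; _>_; _<?_; _≟_)
open import Data.Fin.Properties using (<-trans; <-irrefl; <-asym; all?)
open import Data.Bool using (Bool; true; false)
open import Data.Unit using (tt)
open import Data.Empty using (⊥)
open import Data.List using (List; []; _∷_; _++_; _∷ʳ_)
open import Data.List.Properties using (++-assoc; ∷-injectiveˡ; ∷-injectiveʳ)
open import Data.List.Relation.Unary.Linked as Linked using (Linked; _∷_)
open import Data.List.Relation.Unary.Unique.DecPropositional (_≟_ {5}) using (unique?)
open import Data.List.Membership.Propositional using (_∈_)
open import Data.List.Membership.DecPropositional (_≟_ {5}) using (_∈?_)
open import Data.List.Relation.Unary.Unique.Propositional using (Unique)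
open import Data.Product using (_×_; _,_; ∃; ∃-syntax)
open import Data.Sum using (inj₁; inj₂)
open import Relation.Nullary using (¬_)
open import Relation.Nullary.Decidable using (from-yes; T?; ¬?; _→-dec_)
open import Relation.Binary.PropositionalEquality using (_≡_; refl; subst; sym; trans)
open import Relation.Binary.Construct.Closure.Transitive using (TransClosure; [_]; _∷_)
open import Function.Bundles using (mk⇔)

module _ {n : ℕ} (π : Fin n → Fin n) where

  descending-step : ∀ xs {b c} ys →
                    Linked (λ u v → π u > π v) (xs ++ b ∷ c ∷ ys) → π c < π b
  descending-step []       ys (c<b ∷ _) = c<b
  descending-step (_ ∷ xs) ys desc      = descending-step xs ys (Linked.tail desc)

  -- If the list splits as P ++ x ∷ Q, increasing up to x and decreasing
  -- from x, then it has no entry b strictly below both neighbours a, c: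
  -- a valley inside the decreasing part would need the ascent b < c, and
  -- one inside the increasing part would need the ascent a < b.
  no-valley : ∀ xs {a b c} ys P {x} Q →
              π b < π a → π b < π c →
              xs ++ a ∷ b ∷ c ∷ ys ≡ P ++ x ∷ Q →
              Linked (λ u v → π u < π v) (P ∷ʳ x) →
              Linked (λ u v → π u > π v) (x ∷ Q) → ⊥
  no-valley xs {a} {b} {c} ys [] Q b<a b<c eq _ desc =
    <-asym b<c (descending-step (xs ∷ʳ a) ys (subst (Linked _) (sym regroup) desc))
    where
    -- the valley seen as the pair (b , c) after the prefix xs ∷ʳ a
    regroup : (xs ∷ʳ a) ++ b ∷ c ∷ ys ≡ _ ∷ Q
    regroup = trans (++-assoc xs (a ∷ []) (b ∷ c ∷ ys)) eq
  no-valley []       ys (_ ∷ [])      Q b<a _ refl (a<b ∷ _) _ = <-asym b<a a<b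
  no-valley []       ys (_ ∷ _ ∷ P)   Q b<a _ eq (a<b ∷ _) _
    with refl ← ∷-injectiveˡ eq | refl ← ∷-injectiveˡ (∷-injectiveʳ eq) = <-asym b<a a<b
  no-valley (_ ∷ xs) ys (_ ∷ P)       Q b<a b<c eq inc desc =
    no-valley xs ys P Q b<a b<c (∷-injectiveʳ eq) (Linked.tail inc) desc

  valley-not-bitonic : ∀ xs {a b c} ys → π b < π a → π b < π c →
                       ¬ Bitonic π (xs ++ a ∷ b ∷ c ∷ ys)
  valley-not-bitonic [] ys _ _ (inj₁ ())
  valley-not-bitonic (_ ∷ _) ys _ _ (inj₁ ())
  valley-not-bitonic xs ys b<a b<c (inj₂ (P , x , Q , eq , inc , desc)) =
    no-valley xs ys P Q b<a b<c eq inc desc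

module _ {n : ℕ} (E : Fin n → Fin n → Bool)
         (increasing : ∀ u v → Edge E u v → u < v) where

  path-increasing : ∀ {u v} → TransClosure (Edge E) u v → u < v
  path-increasing [ e ]   = increasing _ _ e
  path-increasing (e ∷ p) = <-trans (increasing _ _ e) (path-increasing p)

  acyclic-if-increasing : ∀ v → ¬ TransClosure (Edge E) v v
  acyclic-if-increasing v cycle = <-irrefl refl (path-increasing cycle)

pattern s₀ = zero
pattern v₁ = suc zero
pattern v₂ = suc (suc zero)
pattern v₃ = suc (suc (suc zero))
pattern t₀ = suc (suc (suc (suc zero)))

edges : Fin 5 → Fin 5 → Bool
edges s₀ v₁ = true
edges s₀ v₂ = true
edges s₀ v₃ = true
edges v₁ v₂ = true
edges v₁ v₃ = true
edges v₂ t₀ = true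
edges v₃ t₀ = true
edges _  _  = false

-- Clockwise neighbours; the outer face is traced through the darts
-- (v₃ , s₀), (s₀ , v₂), (v₂ , t₀), (t₀ , v₃).
rotation : Fin 5 → List (Fin 5)
rotation s₀ = v₂ ∷ v₁ ∷ v₃ ∷ []
rotation v₁ = v₂ ∷ v₃ ∷ s₀ ∷ []
rotation v₂ = t₀ ∷ v₁ ∷ s₀ ∷ []
rotation v₃ = s₀ ∷ v₁ ∷ t₀ ∷ []
rotation t₀ = v₂ ∷ v₃ ∷ []

edges-increasing : ∀ u v → Edge edges u v → u < v
edges-increasing = from-yes (all? λ u → all? λ v → T? (edges u v) →-dec (u <? v))

only-source : ∀ v → (∀ u → ¬ Edge edges u v) → v ≡ s₀
only-source = from-yes (all? λ v → all? (λ u → ¬? (T? (edges u v))) →-dec (v ≟ s₀))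

source-has-no-in-edge : ∀ v → v ≡ s₀ → ∀ u → ¬ Edge edges u v
source-has-no-in-edge _ refl = from-yes (all? λ u → ¬? (T? (edges u s₀)))

only-sink : ∀ v → (∀ w → ¬ Edge edges v w) → v ≡ t₀
only-sink = from-yes (all? λ v → all? (λ w → ¬? (T? (edges v w))) →-dec (v ≟ t₀))

sink-has-no-out-edge : ∀ v → v ≡ t₀ → ∀ w → ¬ Edge edges v w
sink-has-no-out-edge _ refl = from-yes (all? λ w → ¬? (T? (edges t₀ w)))

rotation-sound : ∀ u v → v ∈ rotation u → Adj edges u v
rotation-sound = from-yes (all? λ u → all? λ v → (v ∈? rotation u) →-dec T? (adjᵇ edges u v))

rotation-complete : ∀ u v → Adj edges u v → v ∈ rotation u
rotation-complete = from-yes (all? λ u → all? λ v → T? (adjᵇ edges u v) →-dec (v ∈? rotation u))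

rotation-unique : ∀ u → Unique (rotation u)
rotation-unique = from-yes (all? λ u → unique? (rotation u))

example : PlanarSTGraph 5
example = record
  { E          = edges
  ; rot        = rotation
  ; s          = s₀
  ; t          = t₀
  ; outer      = v₃ , s₀
  ; acyclic    = acyclic-if-increasing edges edges-increasing
  ; source     = λ v → mk⇔ (only-source v) (source-has-no-in-edge v)
  ; sink       = λ v → mk⇔ (only-sink v) (sink-has-no-out-edge v)
  ; rot-unique = rotation-unique
  ; rot-nbrs   = λ u v → mk⇔ (rotation-sound u v) (rotation-complete u v)
  ; euler      = refl    -- 5 vertices + 4 faces = 2 + 7 edges
  ; outer-dart = tt
  ; s-outer    = 1 , refl
  ; t-outer    = 3 , refl
  }

-- The outer face enters s₀ through v₃, so the successor list of s₀ starts
-- right after v₃ in the rotation: it is (v₂ , v₁ , v₃).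
bitonic-at-source : ∀ π → IsBitonic example π → Bitonic π (v₂ ∷ v₁ ∷ v₃ ∷ [])
bitonic-at-source π (bitonic-at-s , _) =
  bitonic-at-s v₃ (v₂ ∷ v₁ ∷ []) [] (0 , refl) refl

corollary1 : ∃[ n ] ∃ λ (G : PlanarSTGraph n) →
    ¬ (∃ λ (π : Fin n → Fin n) → IsSTOrdering G π × IsBitonic G π)
corollary1 = 5 , example , no-bitonic-st-ordering
  where
  no-bitonic-st-ordering : ¬ (∃ λ π → IsSTOrdering example π × IsBitonic example π)
  no-bitonic-st-ordering (π , (_ , respects-edges) , bitonic) =
    valley-not-bitonic π [] []
      (respects-edges v₁ v₂ tt) (respects-edges v₁ v₃ tt)
      (bitonic-at-source π bitonic)
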